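{- Let $q$ be an indeterminate (or a nonzero complex number that is not a root of unity), let $a,b,x,y$ be parameters and $n\ge0$. For $k\ge 0$ put $c_k=q^kb+[k]a$, and define $v(n,n,a,b,y)=1$ and, for $0\le k<n$, $$v(n,k,a,b,y)=\bigl(y\dashv qc_k\bigr)^{n-k-1}\bigl(y-q^nb-[n]a\bigr).$$ Then $$(y\dagger x)^n=\sum_{k=0}^n\begin{bmatrix}n\\k\end{bmatrix}\bigl(c_k\dagger x\bigr)^k\,v(n,k,a,b,y).$$
   Context: $[n]=\frac{1-q^n}{1-q}$, $[n]!=\prod_{j=1}^n[j]$, $\begin{bmatrix}n\\k\end{bmatrix}=\frac{[n]!}{[k]![n-k]!}$. For quantities $y,x$ and $m\ge0$, $(y\dagger x)^m:=\prod_{j=0}^{m-1}(y+q^jx)$ and $(y\dashv x)^m:=\prod_{j=0}^{m-1}(y-q^jx)$ (empty products $=1$). -}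

module Defs where

open import Algebra.Bundles using (CommutativeRing)
open import Data.Nat using (ℕ; zero; suc; _∸_; _<?_)
open import Relation.Nullary using (yes; no)

module QCalc {c ℓ} (R : CommutativeRing c ℓ) where
  open CommutativeRing R hiding (zero)

  pow : Carrier → ℕ → Carrier
  pow q zero    = 1#
  pow q (suc n) = pow q n * q

  -- [n] = 1 + q + ... + q^(n-1)  (= (1-q^n)/(1-q))
  qint : Carrier → ℕ → Carrier
  qint q zero    = 0#
  qint q (suc n) = 1# + q * qint q n

  qbinom : Carrier → ℕ → ℕ → Carrier
  qbinom q n       zero    = 1#
  qbinom q zero    (suc k) = 0#
  qbinom q (suc n) (suc k) = qbinom q n k + pow q (suc k) * qbinom q n (suc k)

  dagger : Carrier → Carrier → Carrier → ℕ → Carrier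
  dagger q y x zero    = 1#
  dagger q y x (suc m) = dagger q y x m * (y + pow q m * x)

  dashv : Carrier → Carrier → Carrier → ℕ → Carrier
  dashv q y x zero    = 1#
  dashv q y x (suc m) = dashv q y x m * (y - pow q m * x)

  ck : Carrier → Carrier → Carrier → ℕ → Carrier
  ck q a b k = pow q k * b + qint q k * a

  -- v(n,k,a,b,y): equals 1 when k = n (and, irrelevantly, when k > n)
  v : Carrier → ℕ → ℕ → Carrier → Carrier → Carrier → Carrier
  v q n k a b y with k <? n
  ... | yes _ = dashv q y (q * ck q a b k) (n ∸ k ∸ 1) * (y - pow q n * b - qint q n * a)
  ... | no  _ = 1#

  sumTo : (ℕ → Carrier) → ℕ → Carrier
  sumTo f zero    = f zero
  sumTo f (suc n) = sumTo f n + f (suc n)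

-- Both sides, as families F n y, have at every point w the q-Taylor expansion
--   F n y = Σ_j [n j] (y ⊣ w)^j F (n - j) w.
-- For (y † x)^n = (y ⊣ -x)^n this is the q-binomial theorem for ⊣-products.  On the right,
-- v(n,k,y) = (y ⊣ qc_k)^m - [m] a (y ⊣ qc_k)^(m-1) with m = n - k, an operation that preserves
-- expansions, and a q-binomial convolution Σ_k [n k] P_k F_k (n - k) y of expanding families
-- expands again because [n k][n-k j] = [n j][n-j k].  Two expanding families that agree at
-- w = c_n for every n agree everywhere, by strong induction on n; and at y = c_n every term of
-- the right side except k = n vanishes, since the last factor of v(n,k,y) is y - c_n.
module Submission where

open import Defs
open import Algebra.Bundles using (CommutativeRing)
open import Data.Nat using (ℕ; suc)
open import Relation.Nullary using (¬_)

open import Algebra.Bundles using (RawRing)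
open import Data.Nat as ℕ using (zero; _∸_; _≤_; _<_; _≤′_; z≤n; s≤s; _≤?_; _<?_)
import Data.Nat.Properties as ℕP

open import Data.Nat.Induction using (<-rec)
open import Data.Product using (_×_; _,_)
open import Data.Sum using (inj₁; inj₂)
open import Data.Maybe using (Maybe; just; nothing)
open import Level using (_⊔_)
open import Relation.Nullary using (yes; no)
open import Relation.Nullary.Negation using (contradiction)
import Relation.Binary.PropositionalEquality as ≡
open ≡ using (_≡_)

m∸n∸o≡m∸o∸n : ∀ m n o → m ∸ n ∸ o ≡ m ∸ o ∸ n
m∸n∸o≡m∸o∸n m n o =
  ≡.trans (ℕP.∸-+-assoc m n o) (≡.trans (≡.cong (m ∸_) (ℕP.+-comm n o)) (≡.sym (ℕP.∸-+-assoc m o n)))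

suc[m∸n∸1]≡m∸n : ∀ {m n} → n < m → suc (m ∸ n ∸ 1) ≡ m ∸ n
suc[m∸n∸1]≡m∸n {suc m} {zero}  _         = ≡.refl
suc[m∸n∸1]≡m∸n {suc m} {suc n} (s≤s n<m) = suc[m∸n∸1]≡m∸n n<m

-- The ring solver of Algebra.Solver.Ring for an arbitrary commutative ring, with
-- integer coefficients represented as pairs (a , b) standing for a - b.
module DifferenceSolver {c ℓ} (R : CommutativeRing c ℓ) where
  open CommutativeRing R hiding (zero)
  open import Algebra.Properties.Ring ring using (x[y-z]≈xy-xz; [y-z]x≈yx-zx; -0#≈0#)
  open import Algebra.Properties.AbelianGroup +-abelianGroup using (⁻¹-anti-homo‿-; ⁻¹-∙-comm)
  open import Algebra.Properties.CommutativeSemigroup +-commutativeSemigroup using (interchange)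
  open import Algebra.Properties.Semiring.Mult.TCOptimised semiring
    using (×-homo-+; ×1-homo-*) renaming (_×_ to _·_)
  open import Algebra.Solver.Ring.AlmostCommutativeRing
    using (_-Raw-AlmostCommutative⟶_; fromCommutativeRing)
  open import Relation.Binary.Reasoning.Setoid setoid

  private
    -- Pairs are kept in lowest terms: the solver closes goals by refl on normal
    -- forms, so equal coefficients must have equal representations.
    cancel : ℕ → ℕ → ℕ × ℕ
    cancel (suc a) (suc b) = cancel a b
    cancel a       zero    = a , zero
    cancel zero    b       = zero , b

    differences : RawRing _ _
    differences = record
      { Carrier = ℕ × ℕ
      ; _≈_     = ≡._≡_
      ; _+_     = λ { (a , b) (c , d) → cancel (a ℕ.+ c) (b ℕ.+ d) }
      ; _*_     = λ { (a , b) (c , d) → cancel (a ℕ.* c ℕ.+ b ℕ.* d) (a ℕ.* d ℕ.+ b ℕ.* c) }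
      ; -_      = λ { (a , b) → b , a }
      ; 0#      = 0 , 0
      ; 1#      = 1 , 0
      }

    ι : ℕ → Carrier
    ι n = n · 1#

    diff : ℕ × ℕ → Carrier
    diff (a , b) = ι a - ι b

    -- Agrees with diff, but sends (a , 0) to ι a, so that con (1 , 0) evaluates to 1# on the nose.
    eval : ℕ × ℕ → Carrier
    eval (a , zero)  = ι a
    eval (a , suc b) = diff (a , suc b)

    eval≈diff : ∀ a b → eval (a , b) ≈ diff (a , b)
    eval≈diff a zero    = sym (trans (+-congˡ -0#≈0#) (+-identityʳ (ι a)))
    eval≈diff a (suc b) = refl

    [a+c]-[b+d]≈[a-b]+[c-d] : ∀ a b c d → (a + c) - (b + d) ≈ (a - b) + (c - d)
    [a+c]-[b+d]≈[a-b]+[c-d] a b c d = begin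
      (a + c) - (b + d)     ≈⟨ +-congˡ (⁻¹-∙-comm b d) ⟨
      (a + c) + (- b - d)   ≈⟨ interchange a c (- b) (- d) ⟩
      (a - b) + (c - d)     ∎

    [a-b]-[c-d]≈[a+d]-[c+b] : ∀ a b c d → (a - b) - (c - d) ≈ (a + d) - (c + b)
    [a-b]-[c-d]≈[a+d]-[c+b] a b c d = begin
      (a - b) - (c - d)     ≈⟨ +-congˡ (⁻¹-anti-homo‿- c d) ⟩
      (a - b) + (d - c)     ≈⟨ interchange a (- b) d (- c) ⟩
      (a + d) + (- b - c)   ≈⟨ +-congˡ (⁻¹-∙-comm b c) ⟩
      (a + d) - (b + c)     ≈⟨ +-congˡ (-‿cong (+-comm b c)) ⟩
      (a + d) - (c + b)     ∎

    diff-+ : ∀ a b c d → diff (a ℕ.+ c , b ℕ.+ d) ≈ diff (a , b) + diff (c , d)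
    diff-+ a b c d =
      trans (+-cong (×-homo-+ 1# a c) (-‿cong (×-homo-+ 1# b d))) ([a+c]-[b+d]≈[a-b]+[c-d] _ _ _ _)

    diff-* : ∀ a b c d → diff (a ℕ.* c ℕ.+ b ℕ.* d , a ℕ.* d ℕ.+ b ℕ.* c) ≈ diff (a , b) * diff (c , d)
    diff-* a b c d = begin
      ι (a ℕ.* c ℕ.+ b ℕ.* d) - ι (a ℕ.* d ℕ.+ b ℕ.* c)  ≈⟨ +-cong (ι-+* a c b d) (-‿cong (ι-+* a d b c)) ⟩
      (ι a * ι c + ι b * ι d) - (ι a * ι d + ι b * ι c)  ≈⟨ [a-b]-[c-d]≈[a+d]-[c+b] _ _ _ _ ⟨
      (ι a * ι c - ι b * ι c) - (ι a * ι d - ι b * ι d)  ≈⟨ +-cong ([y-z]x≈yx-zx _ _ _) (-‿cong ([y-z]x≈yx-zx _ _ _)) ⟨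
      (ι a - ι b) * ι c - (ι a - ι b) * ι d              ≈⟨ x[y-z]≈xy-xz _ _ _ ⟨
      (ι a - ι b) * (ι c - ι d)                          ∎
      where
      ι-+* : ∀ a c b d → ι (a ℕ.* c ℕ.+ b ℕ.* d) ≈ ι a * ι c + ι b * ι d
      ι-+* a c b d = trans (×-homo-+ 1# (a ℕ.* c) (b ℕ.* d)) (+-cong (×1-homo-* a c) (×1-homo-* b d))

    eval-cancel : ∀ a b → eval (cancel a b) ≈ diff (a , b)
    eval-cancel (suc a) (suc b) = begin
      eval (cancel a b)           ≈⟨ eval-cancel a b ⟩
      diff (a , b)                ≈⟨ +-identityˡ _ ⟨
      0# + diff (a , b)           ≈⟨ +-congʳ (-‿inverseʳ 1#) ⟨
      diff (1 , 1) + diff (a , b) ≈⟨ diff-+ 1 1 a b ⟨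
      diff (suc a , suc b)        ∎
    eval-cancel zero    zero    = eval≈diff 0 0
    eval-cancel (suc a) zero    = eval≈diff (suc a) 0
    eval-cancel zero    (suc b) = refl

    embedding : differences -Raw-AlmostCommutative⟶ fromCommutativeRing R
    embedding = record
      { ⟦_⟧    = eval
      ; +-homo = λ { (a , b) (c , d) → trans (eval-cancel (a ℕ.+ c) (b ℕ.+ d))
          (trans (diff-+ a b c d) (sym (+-cong (eval≈diff a b) (eval≈diff c d)))) }
      ; *-homo = λ { (a , b) (c , d) → trans (eval-cancel (a ℕ.* c ℕ.+ b ℕ.* d) (a ℕ.* d ℕ.+ b ℕ.* c))
          (trans (diff-* a b c d) (sym (*-cong (eval≈diff a b) (eval≈diff c d)))) }
      ; -‿homo = λ { (a , b) →
          trans (eval≈diff b a) (trans (sym (⁻¹-anti-homo‿- (ι a) (ι b))) (-‿cong (sym (eval≈diff a b)))) }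
      ; 0-homo = refl
      ; 1-homo = refl
      }

    _≟ᶜ_ : ∀ x y → Maybe (eval x ≈ eval y)
    (a , b) ≟ᶜ (c , d) with a ℕ.≟ c | b ℕ.≟ d
    ... | yes ≡.refl | yes ≡.refl = just refl
    ... | _          | _          = nothing

  open import Algebra.Solver.Ring differences (fromCommutativeRing R) embedding _≟ᶜ_ public

  :0# :1# : ∀ {n} → Polynomial n
  :0# = con (0 , 0)
  :1# = con (1 , 0)

module Sums {c ℓ} (R : CommutativeRing c ℓ) where
  open CommutativeRing R hiding (zero)
  open QCalc R using (sumTo)
  open import Algebra.Properties.CommutativeSemigroup +-commutativeSemigroup using (interchange)
  open import Algebra.Properties.AbelianGroup +-abelianGroup using (⁻¹-∙-comm)

  sumTo-cong≤ : ∀ {f g : ℕ → Carrier} n → (∀ k → k ≤ n → f k ≈ g k) → sumTo f n ≈ sumTo g n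
  sumTo-cong≤ zero    f≈g = f≈g 0 z≤n
  sumTo-cong≤ (suc n) f≈g =
    +-cong (sumTo-cong≤ n (λ k k≤n → f≈g k (ℕP.m≤n⇒m≤1+n k≤n))) (f≈g (suc n) ℕP.≤-refl)

  sumTo-cong : ∀ {f g : ℕ → Carrier} n → (∀ k → f k ≈ g k) → sumTo f n ≈ sumTo g n
  sumTo-cong n f≈g = sumTo-cong≤ n (λ k _ → f≈g k)

  sumTo-+ : ∀ (f g : ℕ → Carrier) n → sumTo (λ k → f k + g k) n ≈ sumTo f n + sumTo g n
  sumTo-+ f g zero    = refl
  sumTo-+ f g (suc n) = trans (+-congʳ (sumTo-+ f g n)) (interchange _ _ _ _)

  sumTo-- : ∀ (f g : ℕ → Carrier) n → sumTo (λ k → f k - g k) n ≈ sumTo f n - sumTo g n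
  sumTo-- f g zero    = refl
  sumTo-- f g (suc n) = begin
    sumTo (λ k → f k - g k) n + (f (suc n) - g (suc n))  ≈⟨ +-congʳ (sumTo-- f g n) ⟩
    (sumTo f n - sumTo g n) + (f (suc n) - g (suc n))    ≈⟨ interchange _ _ _ _ ⟩
    (sumTo f n + f (suc n)) + (- sumTo g n - g (suc n))  ≈⟨ +-congˡ (⁻¹-∙-comm _ _) ⟩
    (sumTo f n + f (suc n)) - (sumTo g n + g (suc n))    ∎
    where open import Relation.Binary.Reasoning.Setoid setoid

  sumTo-*ˡ : ∀ d (f : ℕ → Carrier) n → sumTo (λ k → d * f k) n ≈ d * sumTo f n
  sumTo-*ˡ d f zero    = refl
  sumTo-*ˡ d f (suc n) = trans (+-congʳ (sumTo-*ˡ d f n)) (sym (distribˡ d _ _))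

  sumTo-*ʳ : ∀ d (f : ℕ → Carrier) n → sumTo (λ k → f k * d) n ≈ sumTo f n * d
  sumTo-*ʳ d f zero    = refl
  sumTo-*ʳ d f (suc n) = trans (+-congʳ (sumTo-*ʳ d f n)) (sym (distribʳ d _ _))

  sumTo-suc : ∀ (f : ℕ → Carrier) n → sumTo f (suc n) ≈ f 0 + sumTo (λ k → f (suc k)) n
  sumTo-suc f zero    = refl
  sumTo-suc f (suc n) = trans (+-congʳ (sumTo-suc f n)) (+-assoc _ _ _)

  sumTo-≈0 : ∀ (f : ℕ → Carrier) n → (∀ k → k ≤ n → f k ≈ 0#) → sumTo f n ≈ 0#
  sumTo-≈0 f zero    f≈0 = f≈0 0 z≤n
  sumTo-≈0 f (suc n) f≈0 =
    trans (+-cong (sumTo-≈0 f n (λ k k≤n → f≈0 k (ℕP.m≤n⇒m≤1+n k≤n))) (f≈0 (suc n) ℕP.≤-refl))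
          (+-identityʳ 0#)

  sumTo-last : ∀ (f : ℕ → Carrier) n → (∀ k → k < n → f k ≈ 0#) → sumTo f n ≈ f n
  sumTo-last f zero    _   = refl
  sumTo-last f (suc n) f≈0 = trans (+-congʳ (sumTo-≈0 f n (λ k k≤n → f≈0 k (s≤s k≤n)))) (+-identityˡ _)

  sumTo-extend : ∀ (f : ℕ → Carrier) {n N} → n ≤ N → (∀ k → n < k → f k ≈ 0#) → sumTo f N ≈ sumTo f n
  sumTo-extend f {n} n≤N f≈0 = extend (ℕP.≤⇒≤′ n≤N)
    where
    extend : ∀ {N} → n ≤′ N → sumTo f N ≈ sumTo f n
    extend ℕ.≤′-refl          = refl
    extend (ℕ.≤′-step n≤′N) =
      trans (+-cong (extend n≤′N) (f≈0 _ (s≤s (ℕP.≤′⇒≤ n≤′N)))) (+-identityʳ _)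

  sumTo-swap : ∀ (F : ℕ → ℕ → Carrier) m n →
               sumTo (λ k → sumTo (F k) n) m ≈ sumTo (λ j → sumTo (λ k → F k j) m) n
  sumTo-swap F zero    n = refl
  sumTo-swap F (suc m) n =
    trans (+-congʳ (sumTo-swap F m n)) (sym (sumTo-+ (λ j → sumTo (λ k → F k j) m) (F (suc m)) n))

module GaussianBinomial {c ℓ} (R : CommutativeRing c ℓ) (q : CommutativeRing.Carrier R) where
  open CommutativeRing R hiding (zero)
  open QCalc R
  open DifferenceSolver R using (solve; _:=_; _:+_; _:*_; _:-_; :0#; :1#)
  open import Relation.Binary.Reasoning.Setoid setoid

  q^_ : ℕ → Carrier
  q^ n = pow q n

  [_] : ℕ → Carrier
  [ n ] = qint q n

  [_C_] : ℕ → ℕ → Carrier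
  [ n C k ] = qbinom q n k

  pow-+ : ∀ m n → q^ (m ℕ.+ n) ≈ q^ m * q^ n
  pow-+ zero    n = sym (*-identityˡ _)
  pow-+ (suc m) n = trans (*-congʳ (pow-+ m n)) (swap (q^ m) (q^ n) q)
    where
    swap : ∀ a b c → a * b * c ≈ a * c * b
    swap = solve 3 (λ a b c → a :* b :* c := a :* c :* b) refl

  qint-+ : ∀ m n → [ m ℕ.+ n ] ≈ [ m ] + q^ m * [ n ]
  qint-+ zero    n = sym (trans (+-identityˡ _) (*-identityˡ _))
  qint-+ (suc m) n = trans (+-congˡ (*-congˡ (qint-+ m n))) (expand q [ m ] (q^ m) [ n ])
    where
    expand : ∀ q a p b → 1# + q * (a + p * b) ≈ (1# + q * a) + p * q * b
    expand = solve 4 (λ q a p b → :1# :+ q :* (a :+ p :* b) := (:1# :+ q :* a) :+ p :* q :* b) refl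

  qint-suc : ∀ n → [ suc n ] ≈ [ n ] + q^ n
  qint-suc zero    = solve 1 (λ q → :1# :+ q :* :0# := :0# :+ :1#) refl q
  qint-suc (suc n) = trans (+-congˡ (*-congˡ (qint-suc n))) (expand q [ n ] (q^ n))
    where
    expand : ∀ q a p → 1# + q * (a + p) ≈ (1# + q * a) + p * q
    expand = solve 3 (λ q a p → :1# :+ q :* (a :+ p) := (:1# :+ q :* a) :+ p :* q) refl

  qint-telescope : ∀ n → (1# - q) * [ n ] ≈ 1# - q^ n
  qint-telescope zero    = solve 1 (λ q → (:1# :- q) :* :0# := :1# :- :1#) refl q
  qint-telescope (suc n) = begin
    (1# - q) * (1# + q * [ n ])    ≈⟨ expand q [ n ] ⟩
    (1# - q) + q * ((1# - q) * [ n ]) ≈⟨ +-congˡ (*-congˡ (qint-telescope n)) ⟩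
    (1# - q) + q * (1# - q^ n)     ≈⟨ collect q (q^ n) ⟩
    1# - q^ n * q                  ∎
    where
    expand : ∀ q a → (1# - q) * (1# + q * a) ≈ (1# - q) + q * ((1# - q) * a)
    expand = solve 2 (λ q a → (:1# :- q) :* (:1# :+ q :* a) := (:1# :- q) :+ q :* ((:1# :- q) :* a)) refl
    collect : ∀ q p → (1# - q) + q * (1# - p) ≈ 1# - p * q
    collect = solve 2 (λ q p → (:1# :- q) :+ q :* (:1# :- p) := :1# :- p :* q) refl

  qbinom-congˡ : ∀ {m n} k → m ≡ n → [ m C k ] ≈ [ n C k ]
  qbinom-congˡ k m≡n = reflexive (≡.cong (λ m → [ m C k ]) m≡n)

  qbinom-congʳ : ∀ n {k l} → k ≡ l → [ n C k ] ≈ [ n C l ]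
  qbinom-congʳ n k≡l = reflexive (≡.cong (λ k → [ n C k ]) k≡l)

  qbinom-above : ∀ {n k} → n < k → [ n C k ] ≈ 0#
  qbinom-above {zero}  {suc k} _         = refl
  qbinom-above {suc n} {suc k} (s≤s n<k) = begin
    [ n C k ] + q^ suc k * [ n C suc k ] ≈⟨ +-cong (qbinom-above n<k) (*-congˡ (qbinom-above (ℕP.m≤n⇒m≤1+n n<k))) ⟩
    0# + q^ suc k * 0#                   ≈⟨ trans (+-identityˡ _) (zeroʳ _) ⟩
    0#                                   ∎

  qbinom-diag : ∀ n → [ n C n ] ≈ 1#
  qbinom-diag zero    = refl
  qbinom-diag (suc n) =
    trans (+-cong (qbinom-diag n) (trans (*-congˡ (qbinom-above (ℕP.n<1+n n))) (zeroʳ _))) (+-identityʳ 1#)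

  qbinom-one : ∀ n → [ n C 1 ] ≈ [ n ]
  qbinom-one zero    = refl
  qbinom-one (suc n) = +-congˡ (*-cong (*-identityˡ q) (qbinom-one n))

  qbinom-absorb : ∀ m k → [ m ] * [ m ℕ.+ k C k ] ≈ [ suc k ] * [ m ℕ.+ k C suc k ]
  qbinom-absorb zero    k       =
    trans (zeroˡ _) (sym (trans (*-congˡ (qbinom-above (ℕP.n<1+n k))) (zeroʳ _)))
  qbinom-absorb (suc m) zero    = begin
    [ suc m ] * 1#                     ≈⟨ *-identityʳ _ ⟩
    [ suc m ]                          ≈⟨ qbinom-one (suc m) ⟨
    [ suc m C 1 ]                      ≈⟨ qbinom-congˡ 1 (≡.sym (ℕP.+-identityʳ (suc m))) ⟩
    [ suc m ℕ.+ 0 C 1 ]                ≈⟨ *-identityˡ _ ⟨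
    1# * [ suc m ℕ.+ 0 C 1 ]           ≈⟨ *-congʳ (trans (+-congˡ (zeroʳ q)) (+-identityʳ 1#)) ⟨
    [ 1 ] * [ suc m ℕ.+ 0 C 1 ]        ∎
  qbinom-absorb (suc m) (suc k) = begin
    [ suc m ] * ([ N C k ] + q^ suc k * X)
      ≈⟨ expand [ suc m ] [ N C k ] (q^ suc k) X ⟩
    [ suc m ] * [ N C k ] + q^ suc k * ((1# + q * [ m ]) * X)
      ≈⟨ +-congʳ (trans (*-congˡ (qbinom-congˡ k (ℕP.+-suc m k))) (qbinom-absorb (suc m) k)) ⟩
    [ suc k ] * [ suc m ℕ.+ k C suc k ] + q^ suc k * ((1# + q * [ m ]) * X)
      ≈⟨ +-congʳ (*-congˡ (qbinom-congˡ (suc k) (≡.sym (ℕP.+-suc m k)))) ⟩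
    [ suc k ] * X + q^ suc k * ((1# + q * [ m ]) * X)
      ≈⟨ regroup [ suc k ] X (q^ suc k) q [ m ] ⟩
    ([ suc k ] + q^ suc k) * X + q^ suc k * q * ([ m ] * X)
      ≈⟨ +-cong (*-congʳ (qint-suc (suc k))) (*-congˡ (sym (qbinom-absorb m (suc k)))) ⟨
    [ suc (suc k) ] * X + q^ suc k * q * ([ suc (suc k) ] * [ N C suc (suc k) ])
      ≈⟨ factor [ suc (suc k) ] X (q^ suc k * q) [ N C suc (suc k) ] ⟩
    [ suc (suc k) ] * (X + q^ suc (suc k) * [ N C suc (suc k) ]) ∎
    where
    N = m ℕ.+ suc k
    X = [ N C suc k ]
    expand : ∀ a y p x → a * (y + p * x) ≈ a * y + p * (a * x)
    expand = solve 4 (λ a y p x → a :* (y :+ p :* x) := a :* y :+ p :* (a :* x)) refl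
    regroup : ∀ a x p q b → a * x + p * ((1# + q * b) * x) ≈ (a + p) * x + p * q * (b * x)
    regroup = solve 5 (λ a x p q b → a :* x :+ p :* ((:1# :+ q :* b) :* x) := (a :+ p) :* x :+ p :* q :* (b :* x)) refl
    factor : ∀ a x p z → a * x + p * (a * z) ≈ a * (x + p * z)
    factor = solve 4 (λ a x p z → a :* x :+ p :* (a :* z) := a :* (x :+ p :* z)) refl

  qbinom-sym : ∀ r s → [ r ℕ.+ s C r ] ≈ [ r ℕ.+ s C s ]
  qbinom-sym zero    s       = sym (qbinom-diag s)
  qbinom-sym (suc r) zero    = trans (qbinom-congˡ (suc r) (ℕP.+-identityʳ (suc r))) (qbinom-diag (suc r))
  qbinom-sym (suc r) (suc s) = begin
    [ N C r ] + q^ suc r * [ N C suc r ]  ≈⟨ +-cong (qbinom-sym r (suc s)) (*-congˡ Y≈) ⟩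
    X + q^ suc r * Y                      ≈⟨ rearrange X Y (q^ suc r) (q^ suc s) ⟩
    (Y + q^ suc s * X) + ((1# - q^ suc s) * X - (1# - q^ suc r) * Y)
                                          ≈⟨ +-congˡ (trans (+-congˡ (-‿cong ratio)) (-‿inverseʳ _)) ⟩
    (Y + q^ suc s * X) + 0#               ≈⟨ +-identityʳ _ ⟩
    Y + q^ suc s * X                      ∎
    where
    N = r ℕ.+ suc s
    X = [ N C suc s ]
    Y = [ N C s ]
    Y≈ : [ N C suc r ] ≈ Y
    Y≈ = trans (qbinom-congˡ (suc r) (ℕP.+-suc r s))
               (trans (qbinom-sym (suc r) s) (qbinom-congˡ s (≡.sym (ℕP.+-suc r s))))
    ratio : (1# - q^ suc r) * Y ≈ (1# - q^ suc s) * X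
    ratio = begin
      (1# - q^ suc r) * Y             ≈⟨ *-congʳ (qint-telescope (suc r)) ⟨
      (1# - q) * [ suc r ] * Y        ≈⟨ *-assoc _ _ _ ⟩
      (1# - q) * ([ suc r ] * Y)      ≈⟨ *-congˡ absorbed ⟩
      (1# - q) * ([ suc s ] * X)      ≈⟨ *-assoc _ _ _ ⟨
      (1# - q) * [ suc s ] * X        ≈⟨ *-congʳ (qint-telescope (suc s)) ⟩
      (1# - q^ suc s) * X             ∎
      where
      absorbed : [ suc r ] * Y ≈ [ suc s ] * X
      absorbed = begin
        [ suc r ] * Y                           ≈⟨ *-congˡ (qbinom-congˡ s (ℕP.+-suc r s)) ⟩
        [ suc r ] * [ suc r ℕ.+ s C s ]         ≈⟨ qbinom-absorb (suc r) s ⟩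
        [ suc s ] * [ suc r ℕ.+ s C suc s ]     ≈⟨ *-congˡ (qbinom-congˡ (suc s) (ℕP.+-suc r s)) ⟨
        [ suc s ] * X                           ∎
    rearrange : ∀ x y p p′ → x + p * y ≈ (y + p′ * x) + ((1# - p′) * x - (1# - p) * y)
    rearrange = solve 4 (λ x y p p′ →
      x :+ p :* y := (y :+ p′ :* x) :+ ((:1# :- p′) :* x :- (:1# :- p) :* y)) refl

  qbinom-+-*-qbinom : ∀ k l j → [ k ℕ.+ l C k ] * [ l C j ] ≈ [ k ℕ.+ l C k ℕ.+ j ] * [ k ℕ.+ j C k ]
  qbinom-+-*-qbinom zero    l       j       = *-comm _ _
  qbinom-+-*-qbinom (suc k) l       zero    =
    *-cong (qbinom-congʳ (suc k ℕ.+ l) (≡.sym (ℕP.+-identityʳ (suc k))))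
           (sym (trans (qbinom-congˡ (suc k) (ℕP.+-identityʳ (suc k))) (qbinom-diag (suc k))))
  qbinom-+-*-qbinom (suc k) zero    (suc j) = begin
    [ suc k ℕ.+ 0 C suc k ] * 0#                               ≈⟨ zeroʳ _ ⟩
    0#                                                         ≈⟨ zeroˡ _ ⟨
    0# * [ suc k ℕ.+ suc j C suc k ]                           ≈⟨ *-congʳ (qbinom-above beyond) ⟨
    [ suc k ℕ.+ 0 C suc k ℕ.+ suc j ] * [ suc k ℕ.+ suc j C suc k ] ∎
    where
    beyond : suc k ℕ.+ 0 < suc k ℕ.+ suc j
    beyond = ℕP.+-monoʳ-< (suc k) (s≤s z≤n)
  qbinom-+-*-qbinom (suc k) (suc l) (suc j) = begin
    ([ N C k ] + q^ suc k * X) * ([ l C j ] + q^ suc j * [ l C suc j ])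
      ≈⟨ expand [ N C k ] (q^ suc k) X [ l C j ] (q^ suc j) [ l C suc j ] ⟩
    [ N C k ] * [ suc l C suc j ] + q^ suc k * (X * [ l C j ] + q^ suc j * (X * [ l C suc j ]))
      ≈⟨ +-cong (qbinom-+-*-qbinom k (suc l) (suc j)) (*-congˡ (+-cong shifted (*-congˡ shifted′))) ⟩
    [ N C K ] * V + q^ suc k * ([ N C K ] * Z + q^ suc j * (W * (V + q^ suc k * Z)))
      ≈⟨ factor [ N C K ] V (q^ suc k) Z (q^ suc j) W ⟩
    ([ N C K ] + q^ suc k * q^ suc j * W) * (V + q^ suc k * Z)
      ≈⟨ *-congʳ (+-congˡ (*-congʳ (pow-+ (suc k) (suc j)))) ⟨
    ([ N C K ] + q^ suc K * W) * (V + q^ suc k * Z) ∎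
    where
    N = k ℕ.+ suc l
    K = k ℕ.+ suc j
    X = [ N C suc k ]
    V = [ K C k ]
    Z = [ K C suc k ]
    W = [ N C suc K ]
    N≡ : suc k ℕ.+ l ≡ N
    N≡ = ≡.sym (ℕP.+-suc k l)
    shifted : X * [ l C j ] ≈ [ N C K ] * Z
    shifted = begin
      X * [ l C j ]                                         ≈⟨ *-congʳ (qbinom-congˡ (suc k) N≡) ⟨
      [ suc k ℕ.+ l C suc k ] * [ l C j ]                   ≈⟨ qbinom-+-*-qbinom (suc k) l j ⟩
      [ suc k ℕ.+ l C suc k ℕ.+ j ] * [ suc k ℕ.+ j C suc k ]
        ≈⟨ *-cong (trans (qbinom-congˡ (suc (k ℕ.+ j)) N≡) (qbinom-congʳ N (≡.sym (ℕP.+-suc k j))))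
                  (qbinom-congˡ (suc k) (≡.sym (ℕP.+-suc k j))) ⟩
      [ N C K ] * Z                                         ∎
    shifted′ : X * [ l C suc j ] ≈ W * (V + q^ suc k * Z)
    shifted′ = begin
      X * [ l C suc j ]                                     ≈⟨ *-congʳ (qbinom-congˡ (suc k) N≡) ⟨
      [ suc k ℕ.+ l C suc k ] * [ l C suc j ]               ≈⟨ qbinom-+-*-qbinom (suc k) l (suc j) ⟩
      [ suc k ℕ.+ l C suc K ] * [ suc K C suc k ]           ≈⟨ *-congʳ (qbinom-congˡ (suc K) N≡) ⟩
      W * (V + q^ suc k * Z)                                ∎
    expand : ∀ a p x b p′ b′ → (a + p * x) * (b + p′ * b′) ≈ a * (b + p′ * b′) + p * (x * b + p′ * (x * b′))
    expand = solve 6 (λ a p x b p′ b′ →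
      (a :+ p :* x) :* (b :+ p′ :* b′) := a :* (b :+ p′ :* b′) :+ p :* (x :* b :+ p′ :* (x :* b′))) refl
    factor : ∀ n v p z p′ w → n * v + p * (n * z + p′ * (w * (v + p * z))) ≈ (n + p * p′ * w) * (v + p * z)
    factor = solve 6 (λ n v p z p′ w →
      n :* v :+ p :* (n :* z :+ p′ :* (w :* (v :+ p :* z))) := (n :+ p :* p′ :* w) :* (v :+ p :* z)) refl

  qbinom-*-qbinom∸ : ∀ n k j → [ n C k ] * [ n ∸ k C j ] ≈ [ n C k ℕ.+ j ] * [ k ℕ.+ j C k ]
  qbinom-*-qbinom∸ n k j with k ≤? n
  ... | yes k≤n = begin
    [ n C k ] * [ n ∸ k C j ]                              ≈⟨ *-congʳ (qbinom-congˡ k n≡) ⟩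
    [ k ℕ.+ (n ∸ k) C k ] * [ n ∸ k C j ]                  ≈⟨ qbinom-+-*-qbinom k (n ∸ k) j ⟩
    [ k ℕ.+ (n ∸ k) C k ℕ.+ j ] * [ k ℕ.+ j C k ]          ≈⟨ *-congʳ (qbinom-congˡ (k ℕ.+ j) n≡) ⟨
    [ n C k ℕ.+ j ] * [ k ℕ.+ j C k ]                      ∎
    where
    n≡ : n ≡ k ℕ.+ (n ∸ k)
    n≡ = ≡.sym (ℕP.m+[n∸m]≡n k≤n)
  ... | no k≰n = begin
    [ n C k ] * [ n ∸ k C j ]                              ≈⟨ *-congʳ (qbinom-above n<k) ⟩
    0# * [ n ∸ k C j ]                                     ≈⟨ zeroˡ _ ⟩
    0#                                                     ≈⟨ zeroˡ _ ⟨
    0# * [ k ℕ.+ j C k ]                                   ≈⟨ *-congʳ (qbinom-above (ℕP.<-≤-trans n<k (ℕP.m≤m+n k j))) ⟨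
    [ n C k ℕ.+ j ] * [ k ℕ.+ j C k ]                      ∎
    where
    n<k : n < k
    n<k = ℕP.≰⇒> k≰n

  qbinom-*-qbinom∸-comm : ∀ n k j → [ n C k ] * [ n ∸ k C j ] ≈ [ n C j ] * [ n ∸ j C k ]
  qbinom-*-qbinom∸-comm n k j = begin
    [ n C k ] * [ n ∸ k C j ]           ≈⟨ qbinom-*-qbinom∸ n k j ⟩
    [ n C k ℕ.+ j ] * [ k ℕ.+ j C k ]   ≈⟨ *-cong (qbinom-congʳ n (ℕP.+-comm k j))
                                                  (trans (qbinom-sym k j) (qbinom-congˡ j (ℕP.+-comm k j))) ⟩
    [ n C j ℕ.+ k ] * [ j ℕ.+ k C j ]   ≈⟨ qbinom-*-qbinom∸ n j k ⟨
    [ n C j ] * [ n ∸ j C k ]           ∎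

module Expansion {c ℓ} (R : CommutativeRing c ℓ) (q : CommutativeRing.Carrier R) where
  open CommutativeRing R hiding (zero)
  open QCalc R
  open Sums R
  open GaussianBinomial R q
  open DifferenceSolver R using (solve; _:=_; _:+_; _:*_; _:-_)
  open import Algebra.Properties.CommutativeSemigroup +-commutativeSemigroup using (x∙yz≈y∙xz)
  open import Relation.Binary.Reasoning.Setoid setoid

  HasExpansion : (ℕ → Carrier → Carrier) → Set (c ⊔ ℓ)
  HasExpansion F = ∀ n y w → F n y ≈ sumTo (λ j → [ n C j ] * (dashv q y w j * F (n ∸ j) w)) n

  -- The j = 0 term of the expansion at w n is the value at w n; all others have lower degree.
  expansion-unique : ∀ {F G} → HasExpansion F → HasExpansion G → (w : ℕ → Carrier) →
                     (∀ n → F n (w n) ≈ G n (w n)) → ∀ n y → F n y ≈ G n y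
  expansion-unique {F} {G} expF expG w agree = <-rec _ step
    where
    step : ∀ n → (∀ {m} → m < n → ∀ y → F m y ≈ G m y) → ∀ y → F n y ≈ G n y
    step n ih y = begin
      F n y                                                              ≈⟨ expF n y (w n) ⟩
      sumTo (λ j → [ n C j ] * (dashv q y (w n) j * F (n ∸ j) (w n))) n  ≈⟨ sumTo-cong≤ n terms ⟩
      sumTo (λ j → [ n C j ] * (dashv q y (w n) j * G (n ∸ j) (w n))) n  ≈⟨ expG n y (w n) ⟨
      G n y                                                              ∎
      where
      terms : ∀ j → j ≤ n → [ n C j ] * (dashv q y (w n) j * F (n ∸ j) (w n))
                          ≈ [ n C j ] * (dashv q y (w n) j * G (n ∸ j) (w n))
      terms zero    _   = *-congˡ (*-congˡ (agree n))
      terms (suc j) j<n = *-congˡ (*-congˡ (ih (ℕP.∸-monoʳ-< (s≤s z≤n) j<n) (w n)))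

  sumTo-qPascal : ∀ (f : ℕ → Carrier) m →
                  sumTo (λ j → [ suc m C j ] * f j) (suc m) ≈
                  sumTo (λ j → [ m C j ] * f (suc j)) m + sumTo (λ j → q^ j * ([ m C j ] * f j)) m
  sumTo-qPascal f m = begin
    sumTo (λ j → [ suc m C j ] * f j) (suc m)                   ≈⟨ sumTo-suc _ m ⟩
    1# * f 0 + sumTo (λ j → [ suc m C suc j ] * f (suc j)) m    ≈⟨ +-congˡ (trans (sumTo-cong m split) (sumTo-+ _ _ m)) ⟩
    1# * f 0 + (A + sumTo (λ j → h (suc j)) m)                  ≈⟨ x∙yz≈y∙xz _ _ _ ⟩
    A + (1# * f 0 + sumTo (λ j → h (suc j)) m)                  ≈⟨ +-congˡ (+-congʳ (*-identityˡ _)) ⟨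
    A + (h 0 + sumTo (λ j → h (suc j)) m)                       ≈⟨ +-congˡ (sumTo-suc h m) ⟨
    A + sumTo h (suc m)                                         ≈⟨ +-congˡ (sumTo-extend h (ℕP.n≤1+n m) beyond) ⟩
    A + sumTo h m                                               ∎
    where
    A = sumTo (λ j → [ m C j ] * f (suc j)) m
    h : ℕ → Carrier
    h j = q^ j * ([ m C j ] * f j)
    split : ∀ j → [ suc m C suc j ] * f (suc j) ≈ [ m C j ] * f (suc j) + h (suc j)
    split j = trans (distribʳ _ _ _) (+-congˡ (*-assoc _ _ _))
    beyond : ∀ j → m < j → h j ≈ 0#
    beyond j m<j = trans (*-congˡ (trans (*-congʳ (qbinom-above m<j)) (zeroˡ _))) (zeroʳ _)

  dashv-expansion : ∀ z → HasExpansion (λ m y → dashv q y z m)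
  dashv-expansion z zero    y w = sym (trans (*-identityˡ _) (*-identityˡ _))
  dashv-expansion z (suc m) y w = begin
    dashv q y z m * (y - q^ m * z)
      ≈⟨ *-congʳ (dashv-expansion z m y w) ⟩
    sumTo (λ j → [ m C j ] * (e j * d (m ∸ j))) m * (y - q^ m * z)
      ≈⟨ sumTo-*ʳ _ _ m ⟨
    sumTo (λ j → [ m C j ] * (e j * d (m ∸ j)) * (y - q^ m * z)) m
      ≈⟨ sumTo-cong≤ m split ⟩
    sumTo (λ j → [ m C j ] * f (suc j) + q^ j * ([ m C j ] * f j)) m
      ≈⟨ sumTo-+ _ _ m ⟩
    sumTo (λ j → [ m C j ] * f (suc j)) m + sumTo (λ j → q^ j * ([ m C j ] * f j)) m
      ≈⟨ sumTo-qPascal f m ⟨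
    sumTo (λ j → [ suc m C j ] * f j) (suc m) ∎
    where
    e d : ℕ → Carrier
    e j = dashv q y w j
    d i = dashv q w z i
    f : ℕ → Carrier
    f j = e j * d (suc m ∸ j)
    split : ∀ j → j ≤ m → [ m C j ] * (e j * d (m ∸ j)) * (y - q^ m * z) ≈ [ m C j ] * f (suc j) + q^ j * ([ m C j ] * f j)
    split j j≤m = begin
      [ m C j ] * (e j * d (m ∸ j)) * (y - q^ m * z)
        ≈⟨ *-congˡ (+-congˡ (-‿cong (*-congʳ q^m≈))) ⟩
      [ m C j ] * (e j * d (m ∸ j)) * (y - q^ j * q^ (m ∸ j) * z)
        ≈⟨ via-w [ m C j ] (e j) (d (m ∸ j)) y (q^ j) (q^ (m ∸ j)) z w ⟩
      [ m C j ] * f (suc j) + q^ j * ([ m C j ] * (e j * d (suc (m ∸ j))))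
        ≈⟨ +-congˡ (reflexive (≡.cong (λ i → q^ j * ([ m C j ] * (e j * d i))) (≡.sym (ℕP.+-∸-assoc 1 j≤m)))) ⟩
      [ m C j ] * f (suc j) + q^ j * ([ m C j ] * f j) ∎
      where
      q^m≈ : q^ m ≈ q^ j * q^ (m ∸ j)
      q^m≈ = trans (reflexive (≡.cong q^_ (≡.sym (ℕP.m+[n∸m]≡n j≤m)))) (pow-+ j (m ∸ j))
      -- y - q^m z = (y - q^j w) + q^j (w - q^(m-j) z)
      via-w : ∀ b e d y p p′ z w →
              b * (e * d) * (y - p * p′ * z) ≈ b * (e * (y - p * w) * d) + p * (b * (e * (d * (w - p′ * z))))
      via-w = solve 8 (λ b e d y p p′ z w →
        b :* (e :* d) :* (y :- p :* p′ :* z) := b :* (e :* (y :- p :* w) :* d) :+ p :* (b :* (e :* (d :* (w :- p′ :* z))))) refl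

  perturb : Carrier → (ℕ → Carrier → Carrier) → ℕ → Carrier → Carrier
  perturb a F m y = F m y - [ m ] * a * F (m ∸ 1) y

  perturb-expansion : ∀ a {F} → HasExpansion F → HasExpansion (perturb a F)
  perturb-expansion a {F} expF m y w = begin
    F m y - [ m ] * a * F (m ∸ 1) y
      ≈⟨ +-cong (expF m y w) (-‿cong (*-congˡ (trans (expF (m ∸ 1) y w) (sym (sumTo-extend g (ℕP.m∸n≤m m 1) beyond))))) ⟩
    sumTo f m - [ m ] * a * sumTo g m      ≈⟨ +-congˡ (-‿cong (sumTo-*ˡ _ g m)) ⟨
    sumTo f m - sumTo (λ j → [ m ] * a * g j) m
                                           ≈⟨ sumTo-- f _ m ⟨
    sumTo (λ j → f j - [ m ] * a * g j) m  ≈⟨ sumTo-cong m combine ⟩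
    sumTo (λ j → [ m C j ] * (dashv q y w j * perturb a F (m ∸ j) w)) m ∎
    where
    f g : ℕ → Carrier
    f j = [ m C j ] * (dashv q y w j * F (m ∸ j) w)
    g j = [ m ∸ 1 C j ] * (dashv q y w j * F (m ∸ 1 ∸ j) w)
    beyond : ∀ j → m ∸ 1 < j → g j ≈ 0#
    beyond j lt = trans (*-congʳ (qbinom-above lt)) (zeroˡ _)
    combine : ∀ j → f j - [ m ] * a * g j ≈ [ m C j ] * (dashv q y w j * perturb a F (m ∸ j) w)
    combine j = begin
      f j - [ m ] * a * g j
        ≈⟨ +-congˡ (-‿cong (regroup [ m ] a [ m ∸ 1 C j ] (dashv q y w j) (F (m ∸ 1 ∸ j) w))) ⟩
      f j - [ m ] * [ m ∸ 1 C j ] * (a * (dashv q y w j * F (m ∸ 1 ∸ j) w))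
        ≈⟨ +-congˡ (-‿cong (*-cong coefficient (*-congˡ (*-congˡ (reflexive (≡.cong (λ i → F i w) (m∸n∸o≡m∸o∸n m 1 j))))))) ⟩
      f j - [ m C j ] * [ m ∸ j ] * (a * (dashv q y w j * F (m ∸ j ∸ 1) w))
        ≈⟨ factor [ m C j ] (dashv q y w j) (F (m ∸ j) w) [ m ∸ j ] a (F (m ∸ j ∸ 1) w) ⟩
      [ m C j ] * (dashv q y w j * perturb a F (m ∸ j) w) ∎
      where
      coefficient : [ m ] * [ m ∸ 1 C j ] ≈ [ m C j ] * [ m ∸ j ]
      coefficient = begin
        [ m ] * [ m ∸ 1 C j ]           ≈⟨ *-congʳ (qbinom-one m) ⟨
        [ m C 1 ] * [ m ∸ 1 C j ]       ≈⟨ qbinom-*-qbinom∸-comm m 1 j ⟩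
        [ m C j ] * [ m ∸ j C 1 ]       ≈⟨ *-congˡ (qbinom-one (m ∸ j)) ⟩
        [ m C j ] * [ m ∸ j ]           ∎
      regroup : ∀ i a b e x → i * a * (b * (e * x)) ≈ i * b * (a * (e * x))
      regroup = solve 5 (λ i a b e x → i :* a :* (b :* (e :* x)) := i :* b :* (a :* (e :* x))) refl
      factor : ∀ b e x i a x′ → b * (e * x) - b * i * (a * (e * x′)) ≈ b * (e * (x - i * a * x′))
      factor = solve 6 (λ b e x i a x′ → b :* (e :* x) :- b :* i :* (a :* (e :* x′)) := b :* (e :* (x :- i :* a :* x′))) refl

  convolution : (ℕ → Carrier) → (ℕ → ℕ → Carrier → Carrier) → ℕ → Carrier → Carrier
  convolution P F n y = sumTo (λ k → [ n C k ] * (P k * F k (n ∸ k) y)) n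

  convolution-expansion : ∀ P {F} → (∀ k → HasExpansion (F k)) → HasExpansion (convolution P F)
  convolution-expansion P {F} expF n y w = begin
    sumTo (λ k → [ n C k ] * (P k * F k (n ∸ k) y)) n  ≈⟨ sumTo-cong n expand ⟩
    sumTo (λ k → sumTo (T k) n) n                       ≈⟨ sumTo-swap T n n ⟩
    sumTo (λ j → sumTo (λ k → T k j) n) n               ≈⟨ sumTo-cong n collect ⟩
    sumTo (λ j → [ n C j ] * (dashv q y w j * convolution P F (n ∸ j) w)) n ∎
    where
    T : ℕ → ℕ → Carrier
    T k j = [ n C k ] * (P k * ([ n ∸ k C j ] * (dashv q y w j * F k (n ∸ k ∸ j) w)))
    U : ℕ → ℕ → Carrier
    U j k = [ n ∸ j C k ] * (P k * F k (n ∸ j ∸ k) w)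
    expand : ∀ k → [ n C k ] * (P k * F k (n ∸ k) y) ≈ sumTo (T k) n
    expand k = begin
      [ n C k ] * (P k * F k (n ∸ k) y)
        ≈⟨ *-congˡ (*-congˡ (expF k (n ∸ k) y w)) ⟩
      [ n C k ] * (P k * sumTo (λ j → [ n ∸ k C j ] * (dashv q y w j * F k (n ∸ k ∸ j) w)) (n ∸ k))
        ≈⟨ *-congˡ (*-congˡ (sumTo-extend _ (ℕP.m∸n≤m n k) beyond)) ⟨
      [ n C k ] * (P k * sumTo (λ j → [ n ∸ k C j ] * (dashv q y w j * F k (n ∸ k ∸ j) w)) n)
        ≈⟨ trans (sumTo-*ˡ _ _ n) (*-congˡ (sumTo-*ˡ _ _ n)) ⟨
      sumTo (T k) n ∎
      where
      beyond : ∀ j → n ∸ k < j → [ n ∸ k C j ] * (dashv q y w j * F k (n ∸ k ∸ j) w) ≈ 0#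
      beyond j lt = trans (*-congʳ (qbinom-above lt)) (zeroˡ _)
    collect : ∀ j → sumTo (λ k → T k j) n ≈ [ n C j ] * (dashv q y w j * convolution P F (n ∸ j) w)
    collect j = begin
      sumTo (λ k → T k j) n                                    ≈⟨ sumTo-cong n regroup ⟩
      sumTo (λ k → [ n C j ] * (dashv q y w j * U j k)) n      ≈⟨ trans (sumTo-*ˡ _ _ n) (*-congˡ (sumTo-*ˡ _ _ n)) ⟩
      [ n C j ] * (dashv q y w j * sumTo (U j) n)              ≈⟨ *-congˡ (*-congˡ (sumTo-extend (U j) (ℕP.m∸n≤m n j) beyond)) ⟩
      [ n C j ] * (dashv q y w j * sumTo (U j) (n ∸ j))        ∎
      where
      beyond : ∀ k → n ∸ j < k → U j k ≈ 0#
      beyond k lt = trans (*-congʳ (qbinom-above lt)) (zeroˡ _)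
      regroup : ∀ k → T k j ≈ [ n C j ] * (dashv q y w j * U j k)
      regroup k = begin
        T k j
          ≈⟨ pull [ n C k ] (P k) [ n ∸ k C j ] (dashv q y w j) (F k (n ∸ k ∸ j) w) ⟩
        [ n C k ] * [ n ∸ k C j ] * (dashv q y w j * (P k * F k (n ∸ k ∸ j) w))
          ≈⟨ *-cong (qbinom-*-qbinom∸-comm n k j)
                    (*-congˡ (*-congˡ (reflexive (≡.cong (λ i → F k i w) (m∸n∸o≡m∸o∸n n k j))))) ⟩
        [ n C j ] * [ n ∸ j C k ] * (dashv q y w j * (P k * F k (n ∸ j ∸ k) w))
          ≈⟨ push [ n C j ] [ n ∸ j C k ] (dashv q y w j) (P k) (F k (n ∸ j ∸ k) w) ⟩
        [ n C j ] * (dashv q y w j * U j k) ∎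
        where
        pull : ∀ b p b′ e x → b * (p * (b′ * (e * x))) ≈ b * b′ * (e * (p * x))
        pull = solve 5 (λ b p b′ e x → b :* (p :* (b′ :* (e :* x))) := b :* b′ :* (e :* (p :* x))) refl
        push : ∀ b b′ e p x → b * b′ * (e * (p * x)) ≈ b * (e * (b′ * (p * x)))
        push = solve 5 (λ b b′ e p x → b :* b′ :* (e :* (p :* x)) := b :* (e :* (b′ :* (p :* x)))) refl

module QAbel {ℓ₁ ℓ₂} (R : CommutativeRing ℓ₁ ℓ₂) (q a b x : CommutativeRing.Carrier R) where
  open CommutativeRing R hiding (zero)
  open QCalc R
  open Sums R
  open GaussianBinomial R q
  open Expansion R q
  open DifferenceSolver R using (solve; _:=_; _:+_; _:*_; _:-_; :-_; :0#; :1#)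
  open import Relation.Binary.Reasoning.Setoid setoid

  c : ℕ → Carrier
  c = ck q a b

  c-+ : ∀ m k → c (m ℕ.+ k) ≈ q^ m * c k + [ m ] * a
  c-+ m k = begin
    q^ (m ℕ.+ k) * b + [ m ℕ.+ k ] * a                   ≈⟨ +-cong (*-congʳ (pow-+ m k)) (*-congʳ (qint-+ m k)) ⟩
    q^ m * q^ k * b + ([ m ] + q^ m * [ k ]) * a          ≈⟨ regroup (q^ m) (q^ k) b [ m ] [ k ] a ⟩
    q^ m * (q^ k * b + [ k ] * a) + [ m ] * a             ∎
    where
    regroup : ∀ p p′ b i i′ a → p * p′ * b + (i + p * i′) * a ≈ p * (p′ * b + i′ * a) + i * a
    regroup = solve 6 (λ p p′ b i i′ a → p :* p′ :* b :+ (i :+ p :* i′) :* a := p :* (p′ :* b :+ i′ :* a) :+ i :* a) refl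

  dagger≈dashv : ∀ y n → dagger q y x n ≈ dashv q y (- x) n
  dagger≈dashv y zero    = refl
  dagger≈dashv y (suc n) = *-cong (dagger≈dashv y n) (solve 3 (λ y p x → y :+ p :* x := y :- p :* (:- x)) refl y (q^ n) x)

  perturbed : Carrier → ℕ → Carrier → Carrier
  perturbed z = perturb a (λ m y → dashv q y z m)

  perturbed-suc : ∀ z m y → perturbed z (suc m) y ≈ dashv q y z m * (y - (q^ m * z + [ suc m ] * a))
  perturbed-suc z m y = collect (dashv q y z m) y (q^ m) z [ suc m ] a
    where
    collect : ∀ e y p z i a → e * (y - p * z) - i * a * e ≈ e * (y - (p * z + i * a))
    collect = solve 6 (λ e y p z i a → e :* (y :- p :* z) :- i :* a :* e := e :* (y :- (p :* z :+ i :* a))) refl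

  v-below : ∀ {n k} y → k < n → v q n k a b y ≈ dashv q y (q * c k) (n ∸ k ∸ 1) * (y - q^ n * b - [ n ] * a)
  v-below {n} {k} y k<n with k <? n
  ... | yes _   = refl
  ... | no  k≮n = contradiction k<n k≮n

  v-diag : ∀ n y → v q n n a b y ≈ 1#
  v-diag n y with n <? n
  ... | yes n<n = contradiction n<n (ℕP.n≮n n)
  ... | no  _   = refl

  v≈perturbed : ∀ {n k} y → k ≤ n → v q n k a b y ≈ perturbed (q * c k) (n ∸ k) y
  v≈perturbed {n} {k} y k≤n with ℕP.m≤n⇒m<n∨m≡n k≤n
  ... | inj₂ ≡.refl = begin
    v q n n a b y              ≈⟨ v-diag n y ⟩
    1#                         ≈⟨ solve 1 (λ a → :1# :- :0# :* a :* :1# := :1#) refl a ⟨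
    perturbed (q * c n) 0 y    ≈⟨ reflexive (≡.cong (λ i → perturbed (q * c n) i y) (ℕP.n∸n≡0 n)) ⟨
    perturbed (q * c n) (n ∸ n) y ∎
  ... | inj₁ k<n = begin
    v q n k a b y                                              ≈⟨ v-below y k<n ⟩
    dashv q y (q * c k) m * (y - q^ n * b - [ n ] * a)         ≈⟨ *-congˡ (minus-sum y (q^ n * b) ([ n ] * a)) ⟩
    dashv q y (q * c k) m * (y - c n)                          ≈⟨ *-congˡ (+-congˡ (-‿cong c-n)) ⟩
    dashv q y (q * c k) m * (y - (q^ m * (q * c k) + [ suc m ] * a)) ≈⟨ perturbed-suc (q * c k) m y ⟨
    perturbed (q * c k) (suc m) y                              ≈⟨ reflexive (≡.cong (λ i → perturbed (q * c k) i y) sm≡) ⟩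
    perturbed (q * c k) (n ∸ k) y                              ∎
    where
    m = n ∸ k ∸ 1
    sm≡ : suc m ≡ n ∸ k
    sm≡ = suc[m∸n∸1]≡m∸n k<n
    c-n : c n ≈ q^ m * (q * c k) + [ suc m ] * a
    c-n = begin
      c n                              ≈⟨ reflexive (≡.cong c (≡.trans (≡.cong (ℕ._+ k) sm≡) (ℕP.m∸n+n≡m (ℕP.<⇒≤ k<n)))) ⟨
      c (suc m ℕ.+ k)                  ≈⟨ c-+ (suc m) k ⟩
      q^ m * q * c k + [ suc m ] * a   ≈⟨ +-congʳ (*-assoc _ _ _) ⟩
      q^ m * (q * c k) + [ suc m ] * a ∎
    minus-sum : ∀ y u u′ → y - u - u′ ≈ y - (u + u′)
    minus-sum = solve 3 (λ y u u′ → y :- u :- u′ := y :- (u :+ u′)) refl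

  -- The last factor of v(n, k, y) is y - c n.
  v-at-c : ∀ {n k} → k < n → v q n k a b (c n) ≈ 0#
  v-at-c {n} {k} k<n = trans (v-below (c n) k<n) (trans (*-congˡ (cancel (q^ n * b) ([ n ] * a))) (zeroʳ _))
    where
    cancel : ∀ u u′ → (u + u′) - u - u′ ≈ 0#
    cancel = solve 2 (λ u u′ → (u :+ u′) :- u :- u′ := :0#) refl

  rhs : ℕ → Carrier → Carrier
  rhs n y = sumTo (λ k → qbinom q n k * dagger q (c k) x k * v q n k a b y) n

  rhs-at-c : ∀ n → rhs n (c n) ≈ dagger q (c n) x n
  rhs-at-c n = begin
    rhs n (c n)                                           ≈⟨ sumTo-last _ n (λ k k<n → trans (*-congˡ (v-at-c k<n)) (zeroʳ _)) ⟩
    [ n C n ] * dagger q (c n) x n * v q n n a b (c n)    ≈⟨ *-cong (*-congʳ (qbinom-diag n)) (v-diag n (c n)) ⟩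
    1# * dagger q (c n) x n * 1#                          ≈⟨ trans (*-identityʳ _) (*-identityˡ _) ⟩
    dagger q (c n) x n                                    ∎

  rhs-convolution : ℕ → Carrier → Carrier
  rhs-convolution = convolution (λ k → dagger q (c k) x k) (λ k → perturbed (q * c k))

  rhs-convolution-expansion : HasExpansion rhs-convolution
  rhs-convolution-expansion = convolution-expansion _ (λ k → perturb-expansion a (dashv-expansion (q * c k)))

  rhs≈rhs-convolution : ∀ n y → rhs n y ≈ rhs-convolution n y
  rhs≈rhs-convolution n y =
    sumTo-cong≤ n (λ k k≤n → trans (*-assoc _ _ _) (*-congˡ (*-congˡ (v≈perturbed y k≤n))))

mainTheorem15 : ∀ {c ℓ} (R : CommutativeRing c ℓ) →
    let open CommutativeRing R
        open QCalc R
    in (q a b x y : Carrier) →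
       ¬ (q ≈ 0#) → (∀ m → ¬ (pow q (suc m) ≈ 1#)) →
       (n : ℕ) →
       dagger q y x n ≈
         sumTo (λ k → qbinom q n k * dagger q (ck q a b k) x k * v q n k a b y) n
mainTheorem15 R q a b x y _ _ n = begin
  dagger q y x n         ≈⟨ dagger≈dashv y n ⟩
  dashv q y (- x) n      ≈⟨ expansion-unique (dashv-expansion (- x)) rhs-convolution-expansion c agree n y ⟩
  rhs-convolution n y    ≈⟨ rhs≈rhs-convolution n y ⟨
  rhs n y                ∎
  where
  open CommutativeRing R
  open QCalc R
  open Expansion R q
  open QAbel R q a b x
  open import Relation.Binary.Reasoning.Setoid setoid

  agree : ∀ n → dashv q (c n) (- x) n ≈ rhs-convolution n (c n)
  agree n = begin
    dashv q (c n) (- x) n     ≈⟨ dagger≈dashv (c n) n ⟨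
    dagger q (c n) x n        ≈⟨ rhs-at-c n ⟨
    rhs n (c n)               ≈⟨ rhs≈rhs-convolution n (c n) ⟩
    rhs-convolution n (c n)   ∎
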